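{- Let $s$ and $t$ be connected ribbons with the same number of rows. If the skew Schur function $s_s$ is a nonzero scalar multiple of $s_t$, then $s_s=s_t$.
   Context: A ribbon is a skew shape (in English notation) containing no $2\times2$ square of boxes; a connected ribbon is a connected such shape. For a skew shape $\alpha$, $s_\alpha$ denotes its skew Schur function (sum over fillings with positive integers, weakly increasing along rows and strictly increasing down columns, of the corresponding monomials), an element of the ring of symmetric functions over a field $k$. -}

module Defs where

open import Level using (Level; suc; _⊔_)
open import Data.Nat as ℕ using (ℕ; zero; _≤_; _<_; _≡ᵇ_; _<ᵇ_; _≤ᵇ_)
open import Data.Bool using (Bool; true; false; _∧_; _∨_; not; if_then_else_)
open import Data.List using (List; []; _∷_; map; concatMap; upTo; length; zip; foldr)
open import Data.Product using (Σ; ∃; _×_; _,_)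
open import Data.Sum using (_⊎_)
open import Relation.Nullary using (¬_)
open import Relation.Binary.PropositionalEquality using (_≡_)
open import Relation.Binary.Construct.Closure.ReflexiveTransitive using (Star)
open import Algebra.Bundles using (CommutativeRing)

record Field (c ℓ : Level) : Set (Level.suc (c ⊔ ℓ)) where
  field
    commutativeRing : CommutativeRing c ℓ
  open CommutativeRing commutativeRing public
  field
    1≉0     : ¬ (1# ≈ 0#)
    inverse : ∀ x → ¬ (x ≈ 0#) → ∃ λ y → x * y ≈ 1#

ι : ∀ {c ℓ} (K : Field c ℓ) → ℕ → Field.Carrier K
ι K zero      = Field.0# K
ι K (ℕ.suc n) = Field._+_ K (Field.1# K) (ι K n)

-- Lists of naturals, indexed with default value 0

_!_ : List ℕ → ℕ → ℕ
[]       ! i         = 0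
(x ∷ xs) ! zero      = x
(x ∷ xs) ! ℕ.suc i   = xs ! i

-- a partition: weakly decreasing list of naturals (trailing zeros allowed)
IsPartition : List ℕ → Set
IsPartition λs = ∀ i → λs ! ℕ.suc i ≤ λs ! i

-- Skew shapes λ/μ (English notation; row i, column j, both 0-based)

record SkewShape : Set where
  field
    outer inner  : List ℕ
    outer-part   : IsPartition outer
    inner-part   : IsPartition inner
    contained    : ∀ i → inner ! i ≤ outer ! i

open SkewShape public

Cell : SkewShape → ℕ × ℕ → Set
Cell α (i , j) = (inner α ! i ≤ j) × (j < outer α ! i)

IsRibbon : SkewShape → Set
IsRibbon α = ¬ (Σ ℕ λ i → Σ ℕ λ j →
  Cell α (i , j) × Cell α (i , ℕ.suc j) ×
  Cell α (ℕ.suc i , j) × Cell α (ℕ.suc i , ℕ.suc j))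

Adjacent : SkewShape → ℕ × ℕ → ℕ × ℕ → Set
Adjacent α (i , j) (i' , j') =
  Cell α (i , j) × Cell α (i' , j') ×
  ( (i ≡ i' × (ℕ.suc j ≡ j' ⊎ j ≡ ℕ.suc j'))
  ⊎ (j ≡ j' × (ℕ.suc i ≡ i' ⊎ i ≡ ℕ.suc i')) )

IsConnected : SkewShape → Set
IsConnected α = ∀ p q → Cell α p → Cell α q → Star (Adjacent α) p q

IsConnectedRibbon : SkewShape → Set
IsConnectedRibbon α = IsRibbon α × IsConnected α

numRows : SkewShape → ℕ
numRows α = foldr (λ i n → if inner α ! i <ᵇ outer α ! i then ℕ.suc n else n)
                  0 (upTo (length (outer α)))

-- The coefficient of x₁^{a₁} ⋯ x_n^{a_n} (a a list of naturals of
-- length n) is the number of semistandard fillings of λ/μ with content a.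

cells : SkewShape → List (ℕ × ℕ)
cells α = concatMap (λ i → map (λ d → (i , inner α ! i ℕ.+ d))
                              (upTo (outer α ! i ℕ.∸ inner α ! i)))
                    (upTo (length (outer α)))

words : ℕ → ℕ → List (List ℕ)
words zero      n = [] ∷ []
words (ℕ.suc m) n = concatMap (λ v → map (v ∷_) (words m n)) (map ℕ.suc (upTo n))

Entry : Set
Entry = (ℕ × ℕ) × ℕ

allᵇ : ∀ {A : Set} → (A → Bool) → List A → Bool
allᵇ p = foldr (λ x b → p x ∧ b) true

-- rows weakly increasing, columns strictly increasing (downwards)
pairOK : Entry → Entry → Bool
pairOK ((i , j) , v) ((i' , j') , v') =
  (not ((i ≡ᵇ i') ∧ (j <ᵇ j')) ∨ (v ≤ᵇ v')) ∧
  (not ((j ≡ᵇ j') ∧ (i <ᵇ i')) ∨ (v <ᵇ v'))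

isSemistandard : List Entry → Bool
isSemistandard T = allᵇ (λ e → allᵇ (λ e' → pairOK e e') T) T

countValue : ℕ → List Entry → ℕ
countValue k = foldr (λ e n → if Data.Product.proj₂ e ≡ᵇ k then ℕ.suc n else n) 0

-- value k+1 occurs exactly a_{k+1} = a ! k times, for k < n
hasContent : List ℕ → List Entry → Bool
hasContent a T = allᵇ (λ k → countValue (ℕ.suc k) T ≡ᵇ (a ! k)) (upTo (length a))

countTrue : ∀ {A : Set} → (A → Bool) → List A → ℕ
countTrue p = foldr (λ x n → if p x then ℕ.suc n else n) 0

coeff : SkewShape → List ℕ → ℕ
coeff α a = countTrue (λ T → isSemistandard T ∧ hasContent a T)
                      (map (zip (cells α)) (words (length (cells α)) (length a)))

-- s_α = γ · s_β in Λ_K  (equality of all monomial coefficients)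
SchurEq : ∀ {c ℓ} (K : Field c ℓ) → SkewShape → Field.Carrier K → SkewShape → Set ℓ
SchurEq K α γ β = ∀ a → ι K (coeff α a) ≈ γ * ι K (coeff β a)
  where open Field K

module Submission where

-- Nothing about ribbons, connectedness or row counts is
-- needed: for ANY skew shapes s, t and any nonzero γ, s_s = γ·s_t forces
-- γ = 1.  Every skew shape α has a distinguished semistandard filling, the
-- "depth filling", which puts into each box its depth, i.e. the number of
-- boxes of its column from the top of its column segment down to it.  Every
-- semistandard filling dominates it box by box, so for the weight
-- Σ_k k·a_k of a content vector a we get:
--   (1) if [x^a] s_α ≠ 0 then weight a ≥ D_α, the entry sum of the depth filling;
--   (2) if weight a ≤ D_α then the depth filling is the only candidate, so [x^a] s_α ≤ 1;
--   (3) hence [x^a] s_α = 1 for the content a of the depth filling.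
-- Comparing coefficients of s_s = γ·s_t at the depth contents a_s, a_t:
-- [x^{a_t}] s_s = γ ≠ 0 and [x^{a_s}] s_t ≠ 0, so D_t ≤ weight a_s = D_s by (1);
-- then (2) gives [x^{a_t}] s_s = 1, i.e. γ = 1.
-- The file develops, in order: Boolean and counting lemmas, the words
-- enumerating candidate fillings, sums of dominated lists, the weight of a
-- content vector, depths in a skew shape, the depth filling and (1)-(3),
-- and finally the theorem.

open import Defs
open import Data.Nat using (ℕ; zero; suc; _+_; _*_; _∸_; _≤_; _<_; _≡ᵇ_; _<ᵇ_; _≤ᵇ_; z≤n; s≤s; _≤?_; _<?_; _≟_)
open import Data.Nat.Properties
open import Data.Nat.ListAction using (sum)
open import Algebra.Properties.CommutativeSemigroup +-commutativeSemigroup using (x∙yz≈y∙xz)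
open import Data.Bool using (Bool; true; false; _∧_; _∨_; not; T; if_then_else_)
open import Data.Bool.Properties using (T-∧; T-≡)
open import Data.List using (List; []; _∷_; map; concat; upTo; applyUpTo; length; zip; cartesianProductWith; _++_)
open import Data.List.Properties using (length-map; length-applyUpTo; ∷-injective)
open import Data.List.Membership.Propositional using (_∈_)
open import Data.List.Membership.Propositional.Properties
  using (∈-map⁺; ∈-map⁻; ∈-concat⁺′; ∈-concat⁻′; ∈-upTo⁺; ∈-upTo⁻; ∈-cartesianProductWith⁺; ∈-cartesianProductWith⁻)
open import Data.List.Relation.Unary.Any using (here; there)
import Data.List.Relation.Unary.All as All
open import Data.List.Relation.Unary.AllPairs using ([]; _∷_)
open import Data.List.Relation.Unary.Unique.Propositional using (Unique)
import Data.List.Relation.Unary.Unique.Propositional.Properties as Unique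
open import Data.List.Relation.Binary.Pointwise using (Pointwise; []; _∷_)
open import Data.Product using (∃; _×_; _,_; proj₁; proj₂)
open import Data.Sum using (inj₁; inj₂)
open import Data.Empty using (⊥-elim)
open import Function using (_∘_; Equivalence)
open import Relation.Nullary using (¬_; yes; no; Dec)
open import Relation.Nullary.Decidable using (_×-dec_)
open import Relation.Binary.PropositionalEquality using (_≡_; _≢_; refl; sym; trans; cong; cong₂; subst; module ≡-Reasoning)

T-from-≡ : ∀ {b} → b ≡ true → T b
T-from-≡ = Equivalence.from T-≡

∧-split : ∀ {a b} → T (a ∧ b) → T a × T b
∧-split = Equivalence.to T-∧

∧-pair : ∀ {a b} → T a → T b → T (a ∧ b)
∧-pair p q = Equivalence.from T-∧ (p , q)

implies⁺ : ∀ {a b} → (T a → T b) → T (not a ∨ b)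
implies⁺ {false} f = _
implies⁺ {true}  f = f _

implies⁻ : ∀ {a b} → T (not a ∨ b) → T a → T b
implies⁻ {true} h _ = h

allᵇ-sound : ∀ {A : Set} (p : A → Bool) {xs x} → T (allᵇ p xs) → x ∈ xs → T (p x)
allᵇ-sound p {y ∷ ys} h (here refl) = proj₁ (∧-split h)
allᵇ-sound p {y ∷ ys} h (there x∈)  = allᵇ-sound p (proj₂ (∧-split h)) x∈

allᵇ-complete : ∀ {A : Set} (p : A → Bool) xs → (∀ {x} → x ∈ xs → T (p x)) → T (allᵇ p xs)
allᵇ-complete p []       f = _
allᵇ-complete p (y ∷ ys) f = ∧-pair (f (here refl)) (allᵇ-complete p ys (f ∘ there))

module _ {A : Set} (p : A → Bool) where

  countTrue-map : ∀ {B : Set} (f : B → A) xs → countTrue p (map f xs) ≡ countTrue (p ∘ f) xs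
  countTrue-map f []       = refl
  countTrue-map f (x ∷ xs) = cong (λ n → if p (f x) then suc n else n) (countTrue-map f xs)

  countTrue-witness : ∀ xs → countTrue p xs ≢ 0 → ∃ λ x → x ∈ xs × T (p x)
  countTrue-witness []       ne = ⊥-elim (ne refl)
  countTrue-witness (x ∷ xs) ne with p x in px
  ... | true  = x , here refl , T-from-≡ px
  ... | false with countTrue-witness xs ne
  ...   | y , y∈ , py = y , there y∈ , py

  countTrue-positive : ∀ xs {x} → x ∈ xs → T (p x) → 1 ≤ countTrue p xs
  countTrue-positive (y ∷ xs) (here refl) py with p y
  ... | true = s≤s z≤n
  countTrue-positive (y ∷ xs) (there x∈) px with p y
  ... | true  = s≤s z≤n
  ... | false = countTrue-positive xs x∈ px

  countTrue-none : ∀ xs → (∀ {x} → x ∈ xs → ¬ T (p x)) → countTrue p xs ≡ 0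
  countTrue-none []       none = refl
  countTrue-none (x ∷ xs) none with p x in px
  ... | true  = ⊥-elim (none (here refl) (T-from-≡ px))
  ... | false = countTrue-none xs (none ∘ there)

  countTrue-≤1 : ∀ xs y → Unique xs → (∀ {x} → x ∈ xs → T (p x) → x ≡ y) → countTrue p xs ≤ 1
  countTrue-≤1 []       y u            only = z≤n
  countTrue-≤1 (x ∷ xs) y (x∉xs ∷ u) only with p x in px
  ... | true  = s≤s (≤-reflexive (countTrue-none xs others-fail))
    where
    others-fail : ∀ {z} → z ∈ xs → ¬ T (p z)
    others-fail z∈ pz = All.lookup x∉xs z∈ (trans (only (here refl) (T-from-≡ px)) (sym (only (there z∈) pz)))
  ... | false = countTrue-≤1 xs y u (only ∘ there)

InRange : ℕ → ℕ → Set
InRange n v = 1 ≤ v × v ≤ n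

letters-sound : ∀ n {v} → v ∈ map suc (upTo n) → InRange n v
letters-sound n v∈ with ∈-map⁻ suc v∈
... | k , k∈ , refl = s≤s z≤n , ∈-upTo⁻ k∈

letters-complete : ∀ n {v} → InRange n v → v ∈ map suc (upTo n)
letters-complete n {suc k} (_ , v≤n) = ∈-map⁺ suc (∈-upTo⁺ v≤n)

prefixes≡cartesianProduct : ∀ (L : List ℕ) (W : List (List ℕ)) →
  concat (map (λ v → map (v ∷_) W) L) ≡ cartesianProductWith _∷_ L W
prefixes≡cartesianProduct []      W = refl
prefixes≡cartesianProduct (v ∷ L) W = cong (map (v ∷_) W ++_) (prefixes≡cartesianProduct L W)

words-suc : ∀ m n → words (suc m) n ≡ cartesianProductWith _∷_ (map suc (upTo n)) (words m n)
words-suc m n = prefixes≡cartesianProduct (map suc (upTo n)) (words m n)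

words-sound : ∀ m n {w} → w ∈ words m n → length w ≡ m × (∀ {v} → v ∈ w → InRange n v)
words-sound zero    n (here refl) = refl , λ ()
words-sound (suc m) n w∈ with ∈-cartesianProductWith⁻ _∷_ (map suc (upTo n)) (words m n) (subst (_ ∈_) (words-suc m n) w∈)
... | v , w′ , v∈ , w′∈ , refl with words-sound m n w′∈
...   | len , range = cong suc len , λ { (here refl) → letters-sound n v∈ ; (there u∈) → range u∈ }

words-complete : ∀ m n w → length w ≡ m → (∀ {v} → v ∈ w → InRange n v) → w ∈ words m n
words-complete zero    n []      refl range = here refl
words-complete (suc m) n (v ∷ w) refl range =
  subst (_ ∈_) (sym (words-suc m n))
    (∈-cartesianProductWith⁺ _∷_ {xs = map suc (upTo n)} (letters-complete n (range (here refl)))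
                                 (words-complete m n w refl (range ∘ there)))

words-unique : ∀ m n → Unique (words m n)
words-unique zero    n = All.[] ∷ []
words-unique (suc m) n =
  subst Unique (sym (words-suc m n))
    (Unique.cartesianProductWith⁺ {xs = map suc (upTo n)} _∷_ ∷-injective
      (Unique.map⁺ suc-injective (Unique.upTo⁺ n)) (words-unique m n))

zip-sound : ∀ {A B : Set} (C : List A) (w : List B) {c v} → (c , v) ∈ zip C w → c ∈ C × v ∈ w
zip-sound (c ∷ C) (v ∷ w) (here refl) = here refl , here refl
zip-sound (c ∷ C) (v ∷ w) (there e∈) with zip-sound C w e∈
... | c∈ , v∈ = there c∈ , there v∈

zip-covers : ∀ {A B : Set} (C : List A) (w : List B) → length w ≡ length C → ∀ {c} → c ∈ C → ∃ λ v → (c , v) ∈ zip C w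
zip-covers (c ∷ C) (v ∷ w) len (here refl) = v , here refl
zip-covers (c ∷ C) (v ∷ w) len (there c∈) with zip-covers C w (suc-injective len) c∈
... | u , e∈ = u , there e∈

zip-map-sound : ∀ {A B : Set} (f : A → B) (C : List A) {c v} → (c , v) ∈ zip C (map f C) → c ∈ C × v ≡ f c
zip-map-sound f (c ∷ C) (here refl) = here refl , refl
zip-map-sound f (c ∷ C) (there e∈) with zip-map-sound f C e∈
... | c∈ , v≡ = there c∈ , v≡

zip-dominates : ∀ {A : Set} (f : A → ℕ) (C : List A) (w : List ℕ) → length w ≡ length C →
  (∀ {c v} → (c , v) ∈ zip C w → f c ≤ v) → Pointwise _≤_ (map f C) w
zip-dominates f []      []      len dom = []
zip-dominates f (c ∷ C) (v ∷ w) len dom = dom (here refl) ∷ zip-dominates f C w (suc-injective len) (dom ∘ there)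

entrySum : List Entry → ℕ
entrySum F = sum (map proj₂ F)

entrySum-zip : ∀ (C : List (ℕ × ℕ)) (w : List ℕ) → length w ≡ length C → entrySum (zip C w) ≡ sum w
entrySum-zip []      []      len = refl
entrySum-zip (c ∷ C) (v ∷ w) len = cong (v +_) (entrySum-zip C w (suc-injective len))

sum-mono : ∀ {xs ys} → Pointwise _≤_ xs ys → sum xs ≤ sum ys
sum-mono []          = z≤n
sum-mono (x≤y ∷ dom) = +-mono-≤ x≤y (sum-mono dom)

sum-rigid : ∀ {xs ys} → Pointwise _≤_ xs ys → sum ys ≤ sum xs → xs ≡ ys
sum-rigid []                              _  = refl
sum-rigid {x ∷ xs} {y ∷ ys} (x≤y ∷ dom) le = cong₂ _∷_ (≤-antisym x≤y y≤x) (sum-rigid dom ys≤xs)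
  where
  y≤x : y ≤ x
  y≤x = +-cancelʳ-≤ (sum ys) y x (≤-trans le (+-monoʳ-≤ x (sum-mono dom)))
  ys≤xs : sum ys ≤ sum xs
  ys≤xs = +-cancelˡ-≤ y (sum ys) (sum xs) (≤-trans le (+-monoˡ-≤ (sum xs) x≤y))

-- The weight Σ_k (o+k+1)·a_k of a content vector a = (a_0, a_1, …), with an offset o;
-- it is the entry sum of every filling with content a.

weightFrom : ℕ → List ℕ → ℕ
weightFrom o []       = 0
weightFrom o (a ∷ as) = suc o * a + weightFrom (suc o) as

weight : List ℕ → ℕ
weight = weightFrom 0

valueWeight : ℕ → ℕ → List Entry → ℕ
valueWeight o zero    F = 0
valueWeight o (suc m) F = suc o * countValue (suc o) F + valueWeight (suc o) m F

countValue-hit : ∀ c v F → countValue v ((c , v) ∷ F) ≡ suc (countValue v F)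
countValue-hit c v F with v ≡ᵇ v in eq
... | true  = refl
... | false = ⊥-elim (subst T eq (≡⇒≡ᵇ v v refl))

countValue-miss : ∀ c v k F → v ≢ k → countValue k ((c , v) ∷ F) ≡ countValue k F
countValue-miss c v k F v≢k with v ≡ᵇ k in eq
... | true  = ⊥-elim (v≢k (≡ᵇ⇒≡ v k (T-from-≡ eq)))
... | false = refl

valueWeight-empty : ∀ o m → valueWeight o m [] ≡ 0
valueWeight-empty o zero    = refl
valueWeight-empty o (suc m) rewrite *-zeroʳ o = valueWeight-empty (suc o) m

valueWeight-below : ∀ o m c v F → v ≤ o → valueWeight o m ((c , v) ∷ F) ≡ valueWeight o m F
valueWeight-below o zero    c v F v≤o = refl
valueWeight-below o (suc m) c v F v≤o =
  cong₂ (λ x y → suc o * x + y) (countValue-miss c v (suc o) F (<⇒≢ (s≤s v≤o)))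
                                (valueWeight-below (suc o) m c v F (m≤n⇒m≤1+n v≤o))

valueWeight-cons : ∀ o m c v F → o < v → v ≤ o + m → valueWeight o m ((c , v) ∷ F) ≡ v + valueWeight o m F
valueWeight-cons o zero c v F o<v v≤o+0 = ⊥-elim (<⇒≱ o<v (subst (v ≤_) (+-identityʳ o) v≤o+0))
valueWeight-cons o (suc m) c v F o<v v≤o+m+1 with v ≟ suc o
... | yes refl = begin
  suc o * countValue (suc o) ((c , suc o) ∷ F) + valueWeight (suc o) m ((c , suc o) ∷ F)
    ≡⟨ cong₂ (λ x y → suc o * x + y) (countValue-hit c (suc o) F)
                                     (valueWeight-below (suc o) m c (suc o) F ≤-refl) ⟩
  suc o * suc n + w            ≡⟨ cong (_+ w) (*-suc (suc o) n) ⟩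
  (suc o + suc o * n) + w      ≡⟨ +-assoc (suc o) (suc o * n) w ⟩
  suc o + (suc o * n + w)      ∎
  where
  open ≡-Reasoning
  n = countValue (suc o) F
  w = valueWeight (suc o) m F
... | no v≢o+1 = begin
  suc o * countValue (suc o) ((c , v) ∷ F) + valueWeight (suc o) m ((c , v) ∷ F)
    ≡⟨ cong₂ (λ x y → suc o * x + y) (countValue-miss c v (suc o) F v≢o+1)
                                     (valueWeight-cons (suc o) m c v F o+1<v (subst (v ≤_) (+-suc o m) v≤o+m+1)) ⟩
  suc o * n + (v + w)          ≡⟨ x∙yz≈y∙xz (suc o * n) v w ⟩
  v + (suc o * n + w)          ∎
  where
  open ≡-Reasoning
  n = countValue (suc o) F
  w = valueWeight (suc o) m F
  o+1<v : suc o < v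
  o+1<v = ≤∧≢⇒< o<v (v≢o+1 ∘ sym)

valueWeight-entrySum : ∀ o m F → (∀ {e} → e ∈ F → o < proj₂ e × proj₂ e ≤ o + m) → valueWeight o m F ≡ entrySum F
valueWeight-entrySum o m []            range = valueWeight-empty o m
valueWeight-entrySum o m ((c , v) ∷ F) range =
  trans (valueWeight-cons o m c v F o<v v≤o+m) (cong (v +_) (valueWeight-entrySum o m F (range ∘ there)))
  where
  o<v = proj₁ (range (here refl))
  v≤o+m = proj₂ (range (here refl))

weightFrom-valueWeight : ∀ o a F → (∀ k → k < length a → a ! k ≡ countValue (suc (o + k)) F) →
  weightFrom o a ≡ valueWeight o (length a) F
weightFrom-valueWeight o []       F content = refl
weightFrom-valueWeight o (x ∷ as) F content =
  cong₂ _+_ (cong (suc o *_) head) (weightFrom-valueWeight (suc o) as F tail)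
  where
  head : x ≡ countValue (suc o) F
  head = trans (content 0 (s≤s z≤n)) (cong (λ z → countValue (suc z) F) (+-identityʳ o))
  tail : ∀ k → k < length as → as ! k ≡ countValue (suc (suc o + k)) F
  tail k k< = trans (content (suc k) (s≤s k<)) (cong (λ z → countValue (suc z) F) (+-suc o k))

content-weight : ∀ a F → T (hasContent a F) → (∀ {e} → e ∈ F → InRange (length a) (proj₂ e)) → weight a ≡ entrySum F
content-weight a F hasC range =
  trans (weightFrom-valueWeight 0 a F content) (valueWeight-entrySum 0 (length a) F range)
  where
  content : ∀ k → k < length a → a ! k ≡ countValue (suc k) F
  content k k< = sym (≡ᵇ⇒≡ _ _ (allᵇ-sound _ hasC (∈-upTo⁺ k<)))

partition-antitone : ∀ xs → IsPartition xs → ∀ {i k} → i ≤ k → xs ! k ≤ xs ! i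
partition-antitone xs p {k = zero}  z≤n    = ≤-refl
partition-antitone xs p {k = suc k} i≤k+1 with m≤n⇒m<n∨m≡n i≤k+1
... | inj₂ refl       = ≤-refl
... | inj₁ (s≤s i≤k) = ≤-trans (p k) (partition-antitone xs p i≤k)

cell-convex : ∀ α {i j i′ j′ k l} → Cell α (i , j) → Cell α (i′ , j′) →
  i ≤ k → k ≤ i′ → j ≤ l → l ≤ j′ → Cell α (k , l)
cell-convex α (μi≤j , _) (_ , j′<λi′) i≤k k≤i′ j≤l l≤j′ =
  ≤-trans (partition-antitone (inner α) (inner-part α) i≤k) (≤-trans μi≤j j≤l) ,
  <-≤-trans (≤-<-trans l≤j′ j′<λi′) (partition-antitone (outer α) (outer-part α) k≤i′)

cell? : ∀ α c → Dec (Cell α c)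
cell? α (i , j) = (inner α ! i ≤? j) ×-dec (j <? outer α ! i)

!-beyond : ∀ xs {i} → length xs ≤ i → xs ! i ≡ 0
!-beyond []       _         = refl
!-beyond (x ∷ xs) (s≤s len) = !-beyond xs len

cell-row-bound : ∀ α {i j} → Cell α (i , j) → i < length (outer α)
cell-row-bound α {i} {j} (_ , j<λi) with i <? length (outer α)
... | yes i<L = i<L
... | no  i≮L = ⊥-elim (n≮0 (subst (j <_) (!-beyond (outer α) (≮⇒≥ i≮L)) j<λi))

rowCells : SkewShape → ℕ → List (ℕ × ℕ)
rowCells α i = map (λ d → (i , inner α ! i + d)) (upTo (outer α ! i ∸ inner α ! i))

cells-sound : ∀ α {c} → c ∈ cells α → Cell α c
cells-sound α c∈ with ∈-concat⁻′ (map (rowCells α) (upTo (length (outer α)))) c∈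
... | row , c∈row , row∈ with ∈-map⁻ (rowCells α) row∈
...   | i , _ , refl with ∈-map⁻ (λ d → (i , inner α ! i + d)) c∈row
...     | d , d∈ , refl = m≤m+n (inner α ! i) d , j<λi
  where
  j<λi : inner α ! i + d < outer α ! i
  j<λi = subst (inner α ! i + d <_) (m+[n∸m]≡n (contained α i)) (+-monoʳ-< (inner α ! i) (∈-upTo⁻ d∈))

cells-complete : ∀ α {i j} → Cell α (i , j) → (i , j) ∈ cells α
cells-complete α {i} {j} (μi≤j , j<λi) =
  ∈-concat⁺′ (subst (λ l → (i , l) ∈ rowCells α i) (m+[n∸m]≡n μi≤j)
                    (∈-map⁺ (λ d → (i , inner α ! i + d)) (∈-upTo⁺ (∸-monoˡ-< j<λi μi≤j))))
             (∈-map⁺ (rowCells α) (∈-upTo⁺ (cell-row-bound α (μi≤j , j<λi))))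

depth : SkewShape → ℕ → ℕ → ℕ
depth α zero    j = 1
depth α (suc i) j with cell? α (i , j)
... | yes _ = suc (depth α i j)
... | no  _ = 1

depth-positive : ∀ α i j → 1 ≤ depth α i j
depth-positive α zero    j = s≤s z≤n
depth-positive α (suc i) j with cell? α (i , j)
... | yes _ = s≤s z≤n
... | no  _ = s≤s z≤n

depth-≤-row : ∀ α i j → depth α i j ≤ suc i
depth-≤-row α zero    j = ≤-refl
depth-≤-row α (suc i) j with cell? α (i , j)
... | yes _ = s≤s (depth-≤-row α i j)
... | no  _ = s≤s z≤n

depth-row-mono : ∀ α i {j j′} → Cell α (i , j) → Cell α (i , j′) → j ≤ j′ → depth α i j ≤ depth α i j′
depth-row-mono α zero    _ _ _ = ≤-refl
depth-row-mono α (suc i) {j} {j′} c c′ j≤j′ with cell? α (i , j) | cell? α (i , j′)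
... | yes above | yes above′ = s≤s (depth-row-mono α i above above′ j≤j′)
... | yes above | no ¬above′ = ⊥-elim (¬above′ (cell-convex α above c′ ≤-refl (n≤1+n i) j≤j′ ≤-refl))
... | no _      | yes _      = s≤s z≤n
... | no _      | no _       = ≤-refl

depth-col-strict : ∀ α {i i′ j} → Cell α (i , j) → Cell α (i′ , j) → i < i′ → depth α i j < depth α i′ j
depth-col-strict α {i} {suc k} {j} c c′ (s≤s i≤k) with cell? α (k , j)
... | no ¬above = ⊥-elim (¬above (cell-convex α c c′ i≤k (n≤1+n k) ≤-refl ≤-refl))
... | yes above with m≤n⇒m<n∨m≡n i≤k
...   | inj₂ refl = ≤-refl
...   | inj₁ i<k  = s≤s (<⇒≤ (depth-col-strict α c above i<k))

semistandard-pair : ∀ F → T (isSemistandard F) → ∀ {e e′} → e ∈ F → e′ ∈ F → T (pairOK e e′)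
semistandard-pair F ss e∈ e′∈ = allᵇ-sound _ (allᵇ-sound _ ss e∈) e′∈

semistandard-column : ∀ F → T (isSemistandard F) → ∀ {i i′ j v v′} →
  ((i , j) , v) ∈ F → ((i′ , j) , v′) ∈ F → i < i′ → v < v′
semistandard-column F ss {i} {i′} {j} e∈ e′∈ i<i′ =
  <ᵇ⇒< _ _ (implies⁻ (proj₂ (∧-split (semistandard-pair F ss e∈ e′∈)))
                     (∧-pair (≡⇒≡ᵇ j j refl) (<⇒<ᵇ i<i′)))

pairOK-intro : ∀ {i j v i′ j′ v′} → (i ≡ i′ → j < j′ → v ≤ v′) → (j ≡ j′ → i < i′ → v < v′) →
  T (pairOK ((i , j) , v) ((i′ , j′) , v′))
pairOK-intro {i} {j} {v} {i′} {j′} {v′} row col = ∧-pair (implies⁺ rowᵇ) (implies⁺ colᵇ)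
  where
  rowᵇ : T ((i ≡ᵇ i′) ∧ (j <ᵇ j′)) → T (v ≤ᵇ v′)
  rowᵇ h = ≤⇒≤ᵇ (row (≡ᵇ⇒≡ i i′ (proj₁ (∧-split h))) (<ᵇ⇒< j j′ (proj₂ (∧-split h))))
  colᵇ : T ((j ≡ᵇ j′) ∧ (i <ᵇ i′)) → T (v <ᵇ v′)
  colᵇ h = <⇒<ᵇ (col (≡ᵇ⇒≡ j j′ (proj₁ (∧-split h))) (<ᵇ⇒< i i′ (proj₂ (∧-split h))))

-- In a semistandard filling with positive entries that covers α, every entry is
-- at least the depth of its box: the column segment above it strictly increases.
depth-lower-bound : ∀ α F → T (isSemistandard F) → (∀ {c} → Cell α c → ∃ λ v → (c , v) ∈ F) →
  (∀ {e} → e ∈ F → 1 ≤ proj₂ e) → ∀ {i j v} → ((i , j) , v) ∈ F → depth α i j ≤ v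
depth-lower-bound α F ss covers positive {zero} e∈ = positive e∈
depth-lower-bound α F ss covers positive {suc i} {j} e∈ with cell? α (i , j)
... | no _      = positive e∈
... | yes above with covers above
...   | v′ , e′∈ = ≤-trans (s≤s (depth-lower-bound α F ss covers positive e′∈))
                           (semistandard-column F ss e′∈ e∈ (n<1+n i))

contentOf : ℕ → List Entry → List ℕ
contentOf n F = applyUpTo (λ k → countValue (suc k) F) n

applyUpTo-! : ∀ (f : ℕ → ℕ) n {k} → k < n → applyUpTo f n ! k ≡ f k
applyUpTo-! f (suc n) {zero}  _         = refl
applyUpTo-! f (suc n) {suc k} (s≤s k<n) = applyUpTo-! (f ∘ suc) n k<n

contentOf-content : ∀ n F → T (hasContent (contentOf n F) F)
contentOf-content n F = allᵇ-complete _ (upTo (length (contentOf n F))) counted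
  where
  counted : ∀ {k} → k ∈ upTo (length (contentOf n F)) → T (countValue (suc k) F ≡ᵇ contentOf n F ! k)
  counted {k} k∈ = ≡⇒≡ᵇ _ _ (sym (applyUpTo-! (λ k → countValue (suc k) F) n (subst (k <_) (length-applyUpTo _ n) (∈-upTo⁻ k∈))))

isTableau : List ℕ → List Entry → Bool
isTableau a F = isSemistandard F ∧ hasContent a F

coeff-words : ∀ α a → coeff α a ≡ countTrue (λ w → isTableau a (zip (cells α) w)) (words (length (cells α)) (length a))
coeff-words α a = countTrue-map (isTableau a) (zip (cells α)) (words (length (cells α)) (length a))

depthOf : SkewShape → ℕ × ℕ → ℕ
depthOf α (i , j) = depth α i j

module TableauWord (α : SkewShape) (a : List ℕ) {w : List ℕ}
                   (w∈ : w ∈ words (length (cells α)) (length a))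
                   (tableau : T (isTableau a (zip (cells α) w))) where

  private
    len : length w ≡ length (cells α)
    len = proj₁ (words-sound (length (cells α)) (length a) w∈)
    range : ∀ {e} → e ∈ zip (cells α) w → InRange (length a) (proj₂ e)
    range e∈ = proj₂ (words-sound (length (cells α)) (length a) w∈) (proj₂ (zip-sound (cells α) w e∈))

  tableau-sum : sum w ≡ weight a
  tableau-sum = sym (trans (content-weight a _ (proj₂ (∧-split tableau)) range) (entrySum-zip (cells α) w len))

  tableau-dominates : Pointwise _≤_ (map (depthOf α) (cells α)) w
  tableau-dominates = zip-dominates (depthOf α) (cells α) w len
    (depth-lower-bound α _ (proj₁ (∧-split tableau))
                       (λ c → zip-covers (cells α) w len (cells-complete α c))
                       (proj₁ ∘ range))

module DepthFilling (α : SkewShape) where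

  depthWord : List ℕ
  depthWord = map (depthOf α) (cells α)

  depthFilling : List Entry
  depthFilling = zip (cells α) depthWord

  depthContent : List ℕ
  depthContent = contentOf (length (outer α)) depthFilling

  depthSum : ℕ
  depthSum = sum depthWord

  -- Depths are at least 1 and at most the number of rows, the length of depthContent.
  depthWord-range : ∀ {v} → v ∈ depthWord → InRange (length depthContent) v
  depthWord-range v∈ with ∈-map⁻ (depthOf α) v∈
  ... | (i , j) , c∈ , refl =
    depth-positive α i j ,
    subst (depth α i j ≤_) (sym (length-applyUpTo _ (length (outer α))))
          (≤-trans (depth-≤-row α i j) (cell-row-bound α (cells-sound α c∈)))

  depthFilling-pair : ∀ {e e′} → e ∈ depthFilling → e′ ∈ depthFilling → T (pairOK e e′)
  depthFilling-pair {(i , j) , _} {(i′ , j′) , _} e∈ e′∈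
    with zip-map-sound (depthOf α) (cells α) e∈ | zip-map-sound (depthOf α) (cells α) e′∈
  ... | c∈ , refl | c′∈ , refl = pairOK-intro row col
    where
    row : i ≡ i′ → j < j′ → depth α i j ≤ depth α i′ j′
    row refl j<j′ = depth-row-mono α i (cells-sound α c∈) (cells-sound α c′∈) (<⇒≤ j<j′)
    col : j ≡ j′ → i < i′ → depth α i j < depth α i′ j′
    col refl i<i′ = depth-col-strict α (cells-sound α c∈) (cells-sound α c′∈) i<i′

  depthFilling-tableau : T (isTableau depthContent depthFilling)
  depthFilling-tableau =
    ∧-pair (allᵇ-complete _ depthFilling (λ e∈ → allᵇ-complete _ depthFilling (depthFilling-pair e∈)))
           (contentOf-content (length (outer α)) depthFilling)

  depthWord-counted : depthWord ∈ words (length (cells α)) (length depthContent)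
  depthWord-counted = words-complete _ _ depthWord (length-map (depthOf α) (cells α)) depthWord-range

  depthContent-weight : weight depthContent ≡ depthSum
  depthContent-weight = sym (TableauWord.tableau-sum α depthContent depthWord-counted depthFilling-tableau)

  coeff-support : ∀ a → coeff α a ≢ 0 → depthSum ≤ weight a
  coeff-support a coeff≢0
    with countTrue-witness _ (words (length (cells α)) (length a)) (subst (_≢ 0) (coeff-words α a) coeff≢0)
  ... | w , w∈ , tableau = subst (depthSum ≤_) tableau-sum (sum-mono tableau-dominates)
    where open TableauWord α a w∈ tableau

  coeff-≤1 : ∀ a → weight a ≤ depthSum → coeff α a ≤ 1
  coeff-≤1 a light =
    subst (_≤ 1) (sym (coeff-words α a))
      (countTrue-≤1 _ (words (length (cells α)) (length a)) depthWord
                    (words-unique (length (cells α)) (length a)) is-depthWord)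
    where
    is-depthWord : ∀ {w} → w ∈ words (length (cells α)) (length a) → T (isTableau a (zip (cells α) w)) → w ≡ depthWord
    is-depthWord w∈ tableau = sym (sum-rigid tableau-dominates (subst (_≤ depthSum) (sym tableau-sum) light))
      where open TableauWord α a w∈ tableau

  coeff-depthContent : coeff α depthContent ≡ 1
  coeff-depthContent = ≤-antisym (coeff-≤1 depthContent (≤-reflexive depthContent-weight))
    (subst (1 ≤_) (sym (coeff-words α depthContent))
           (countTrue-positive _ (words (length (cells α)) (length depthContent)) depthWord-counted depthFilling-tableau))

proportional⇒factor-one : ∀ {c ℓ} (K : Field c ℓ) (s t : SkewShape) (γ : Field.Carrier K) →
  ¬ (Field._≈_ K γ (Field.0# K)) → SchurEq K s γ t → Field._≈_ K γ (Field.1# K)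
proportional⇒factor-one K s t γ γ≉0 s≈γt = begin
  γ                  ≈⟨ at-aₜ ⟨
  ι K (coeff s aₜ)   ≡⟨ cong (ι K) coeff-s-aₜ ⟩
  ι K 1              ≈⟨ ι-one ⟩
  1#                 ∎
  where
  open Field K using (_≈_; 0#; 1#; setoid; 1≉0; *-congˡ; zeroʳ)
    renaming (_*_ to _·_; *-identityʳ to ·-identityʳ; +-identityʳ to ⊕-identityʳ)
  open import Relation.Binary.Reasoning.Setoid setoid
  open DepthFilling

  aₛ aₜ : List ℕ
  aₛ = depthContent s
  aₜ = depthContent t

  ι-one : ι K 1 ≈ 1#
  ι-one = ⊕-identityʳ 1#

  at-aₜ : ι K (coeff s aₜ) ≈ γ
  at-aₜ = begin
    ι K (coeff s aₜ)       ≈⟨ s≈γt aₜ ⟩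
    γ · ι K (coeff t aₜ)   ≡⟨ cong (λ n → γ · ι K n) (coeff-depthContent t) ⟩
    γ · ι K 1              ≈⟨ *-congˡ ι-one ⟩
    γ · 1#                 ≈⟨ ·-identityʳ γ ⟩
    γ                      ∎

  at-aₛ : 1# ≈ γ · ι K (coeff t aₛ)
  at-aₛ = begin
    1#                     ≈⟨ ι-one ⟨
    ι K 1                  ≡⟨ cong (ι K) (sym (coeff-depthContent s)) ⟩
    ι K (coeff s aₛ)       ≈⟨ s≈γt aₛ ⟩
    γ · ι K (coeff t aₛ)   ∎

  coeff-s-aₜ≢0 : coeff s aₜ ≢ 0
  coeff-s-aₜ≢0 eq = γ≉0 (begin
    γ                      ≈⟨ at-aₜ ⟨
    ι K (coeff s aₜ)       ≡⟨ cong (ι K) eq ⟩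
    0#                     ∎)

  coeff-t-aₛ≢0 : coeff t aₛ ≢ 0
  coeff-t-aₛ≢0 eq = 1≉0 (begin
    1#                     ≈⟨ at-aₛ ⟩
    γ · ι K (coeff t aₛ)   ≡⟨ cong (λ n → γ · ι K n) eq ⟩
    γ · 0#                 ≈⟨ zeroʳ γ ⟩
    0#                     ∎)

  -- weight aₜ = D_t ≤ weight aₛ = D_s by (1) for t, so (2) applies to aₜ in s.
  aₜ-light : weight aₜ ≤ depthSum s
  aₜ-light = ≤-trans (≤-reflexive (depthContent-weight t))
                     (≤-trans (coeff-support t aₛ coeff-t-aₛ≢0) (≤-reflexive (depthContent-weight s)))

  coeff-s-aₜ : coeff s aₜ ≡ 1
  coeff-s-aₜ = ≤-antisym (coeff-≤1 s aₜ aₜ-light) (n≢0⇒n>0 coeff-s-aₜ≢0)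

lemma4p10 : ∀ {c ℓ} (K : Field c ℓ) (s t : SkewShape)
    → IsConnectedRibbon s → IsConnectedRibbon t → numRows s ≡ numRows t
    → (γ : Field.Carrier K) → ¬ (Field._≈_ K γ (Field.0# K))
    → SchurEq K s γ t
    → SchurEq K s (Field.1# K) t
lemma4p10 K s t _ _ _ γ γ≉0 s≈γt a =
  Field.trans K (s≈γt a) (Field.*-congʳ K (proportional⇒factor-one K s t γ γ≉0 s≈γt))
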